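{- Let $G$ be a series-parallel graph (SP-graph) with $n \geq 3$ vertices and let $\mathcal{T}$ be its SPQR-tree rooted at any $Q$-node. Then $\mathcal{T}$ contains an $S$-node $\mu$ such that all children of $\mu$ are $Q$-nodes.
   Context: All graphs are simple. An SPQR-tree of a biconnected graph is the standard decomposition tree with respect to separation pairs, with node types $S$ (skeleton a cycle), $P$ (skeleton a bundle of at least three parallel virtual edges), $Q$ (skeleton a single real edge plus the parent virtual edge) and $R$ (triconnected skeleton); all leaves are $Q$-nodes and the tree is rooted at a $Q$-node. An SP-graph is a biconnected graph whose SPQR-tree contains no $R$-nodes. -}

module Defs where

open import Data.Nat using (ℕ; zero; suc; _≤_)
open import Data.Fin using (Fin)
open import Data.Product using (Σ; _×_; _,_; proj₁; proj₂)
open import Data.Sum using (_⊎_)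
open import Data.Unit using (⊤)
open import Data.Empty using (⊥)
open import Data.List using (List; []; _∷_; length; map; lookup; _++_)
open import Data.List.Relation.Unary.All using (All)
open import Data.List.Relation.Unary.Any using (Any; index)
open import Data.List.Membership.Propositional using (_∈_)
open import Data.List.Relation.Unary.Unique.Propositional using (Unique)
open import Relation.Binary.PropositionalEquality using (_≡_; _≢_)
open import Relation.Nullary using (¬_)

record Graph (n : ℕ) : Set₁ where
  field
    Adj    : Fin n → Fin n → Set
    sym    : ∀ {u v} → Adj u v → Adj v u
    irrefl : ∀ {u} → ¬ Adj u u
open Graph public

data Reach {n : ℕ} (A : Fin n → Fin n → Set) (ok : Fin n → Set) : Fin n → Fin n → Set where
  here : ∀ {u} → ok u → Reach A ok u u
  step : ∀ {u w v} → ok u → A u w → Reach A ok w v → Reach A ok u v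

Biconnected : {n : ℕ} → Graph n → Set
Biconnected {n} G =
  (∀ (u v : Fin n) → Reach (Adj G) (λ _ → ⊤) u v) ×
  (∀ (x u v : Fin n) → u ≢ x → v ≢ x → Reach (Adj G) (λ w → w ≢ x) u v)

Edge : ℕ → Set
Edge n = Fin n × Fin n

SameEdge : {n : ℕ} → Edge n → Edge n → Set
SameEdge (a , b) (c , d) = (a ≡ c × b ≡ d) ⊎ (a ≡ d × b ≡ c)

-- SPQR-tree nodes (below the root Q-node).
-- Every node μ has two poles (the endpoints of its parent virtual edge).
--  S s xs       : xs = (c₁ , v₁) ∷ … ∷ (c_k , v_k); skeleton is the cycle
--                 s=v₀, v₁, …, v_k plus the parent virtual edge v₀v_k;
--                 child cᵢ hangs at the virtual edge v_{i-1}vᵢ.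
--  P s t cs     : bundle of the parent virtual edge st and one virtual
--                 edge st per child.
--  R s t vs cs  : skeleton with vertex list vs and edges st (parent) plus
--                 the pole pair of each child.

data SPQR (n : ℕ) : Set where
  Q : Fin n → Fin n → SPQR n
  S : Fin n → List (SPQR n × Fin n) → SPQR n
  P : Fin n → Fin n → List (SPQR n) → SPQR n
  R : Fin n → Fin n → List (Fin n) → List (SPQR n) → SPQR n

lastV : {n : ℕ} {A : Set} → Fin n → List (A × Fin n) → Fin n
lastV a []             = a
lastV a ((_ , b) ∷ xs) = lastV b xs

poles : {n : ℕ} → SPQR n → Edge n
poles (Q u v)       = u , v
poles (S s xs)      = s , lastV s xs
poles (P s t _)     = s , t
poles (R s t _ _)   = s , t

IsQ IsS IsP IsR : {n : ℕ} → SPQR n → Set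
IsQ (Q _ _) = ⊤
IsQ _       = ⊥
IsS (S _ _) = ⊤
IsS _       = ⊥
IsP (P _ _ _) = ⊤
IsP _         = ⊥
IsR (R _ _ _ _) = ⊤
IsR _           = ⊥

mutual
  realEdges : {n : ℕ} → SPQR n → List (Edge n)
  realEdges (Q u v)       = (u , v) ∷ []
  realEdges (S s xs)      = realEdgesS xs
  realEdges (P s t cs)    = realEdgesL cs
  realEdges (R s t vs cs) = realEdgesL cs

  realEdgesL : {n : ℕ} → List (SPQR n) → List (Edge n)
  realEdgesL []       = []
  realEdgesL (c ∷ cs) = realEdges c ++ realEdgesL cs

  realEdgesS : {n : ℕ} → List (SPQR n × Fin n) → List (Edge n)
  realEdgesS []             = []
  realEdgesS ((c , _) ∷ xs) = realEdges c ++ realEdgesS xs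

InV : {n : ℕ} → Fin n → SPQR n → Set
InV x μ = Any (λ e → x ≡ proj₁ e ⊎ x ≡ proj₂ e) (realEdges μ)

IsPole : {n : ℕ} → Fin n → SPQR n → Set
IsPole x μ = x ≡ proj₁ (poles μ) ⊎ x ≡ proj₂ (poles μ)

Glued : {n : ℕ} → List (SPQR n) → Set
Glued {n} cs = ∀ (i j : Fin (length cs)) → i ≢ j → ∀ (x : Fin n) →
  InV x (lookup cs i) → InV x (lookup cs j) → IsPole x (lookup cs i)

SChain : {n : ℕ} → Fin n → List (SPQR n × Fin n) → Set
SChain a []             = ⊤
SChain a ((c , b) ∷ xs) = SameEdge (poles c) (a , b) × SChain b xs

SkAdj : {n : ℕ} → List (Edge n) → Fin n → Fin n → Set
SkAdj es a b = Any (SameEdge (a , b)) es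

Triconnected : {n : ℕ} → List (Fin n) → List (Edge n) → Set
Triconnected {n} vs es =
  4 ≤ length vs × Unique vs ×
  All (λ e → proj₁ e ∈ vs × proj₂ e ∈ vs) es ×
  All (λ e → proj₁ e ≢ proj₂ e) es ×
  (∀ (i j : Fin (length es)) → SameEdge (lookup es i) (lookup es j) → i ≡ j) ×
  (∀ (x y u v : Fin n) → u ∈ vs → v ∈ vs → u ≢ x → u ≢ y → v ≢ x → v ≢ y →
     Reach (SkAdj es) (λ w → w ∈ vs × w ≢ x × w ≢ y) u v)

data Valid {n : ℕ} : SPQR n → Set where
  vQ : ∀ {u v} → u ≢ v → Valid (Q u v)
  vS : ∀ {s xs} →
       2 ≤ length xs →
       Unique (s ∷ map proj₂ xs) →
       SChain s xs →
       All (λ p → ¬ IsS (proj₁ p)) xs →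
       All (λ p → Valid (proj₁ p)) xs →
       Glued (map proj₁ xs) →
       Valid (S s xs)
  vP : ∀ {s t cs} →
       s ≢ t →
       2 ≤ length cs →
       All (λ c → SameEdge (poles c) (s , t)) cs →
       All (λ c → ¬ IsP c) cs →
       All Valid cs →
       Glued cs →
       Valid (P s t cs)
  vR : ∀ {s t vs cs} →
       s ≢ t → s ∈ vs → t ∈ vs →
       Triconnected vs ((s , t) ∷ map poles cs) →
       All Valid cs →
       Glued cs →
       Valid (R s t vs cs)

data NodeOf {n : ℕ} (μ : SPQR n) : SPQR n → Set where
  here : NodeOf μ μ
  inS  : ∀ {s xs} → Any (λ p → NodeOf μ (proj₁ p)) xs → NodeOf μ (S s xs)
  inP  : ∀ {s t cs} → Any (NodeOf μ) cs → NodeOf μ (P s t cs)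
  inR  : ∀ {s t vs cs} → Any (NodeOf μ) cs → NodeOf μ (R s t vs cs)

-- Rooted SPQR-tree: root Q-node for the real edge uv, with its unique child.

record RootedSPQR (n : ℕ) : Set where
  constructor root
  field
    u v   : Fin n
    child : SPQR n
open RootedSPQR public

-- The list es is exactly the edge set of G (each edge once, unordered).
EdgeSetIs : {n : ℕ} → Graph n → List (Edge n) → Set
EdgeSetIs {n} G es =
  All (λ e → Adj G (proj₁ e) (proj₂ e)) es ×
  (∀ (x y : Fin n) → Adj G x y →
     Σ (Any (SameEdge (x , y)) es) λ p →
       ∀ (q : Any (SameEdge (x , y)) es) → index q ≡ index p)

IsSPQRTree : {n : ℕ} → Graph n → RootedSPQR n → Set
IsSPQRTree G (root u v c) =
  Adj G u v × Valid c × SameEdge (poles c) (u , v) ×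
  EdgeSetIs G ((u , v) ∷ realEdges c)

NoRNode : {n : ℕ} → RootedSPQR n → Set
NoRNode {n} T = ∀ (μ : SPQR n) → NodeOf μ (child T) → ¬ IsR μ

SPGraph : {n : ℕ} → Graph n → Set
SPGraph {n} G = Biconnected G × (∀ (T : RootedSPQR n) → IsSPQRTree G T → NoRNode T)

SNodeWithQChildren : {n : ℕ} → SPQR n → Set
SNodeWithQChildren (S s xs) = All (λ p → IsQ (proj₁ p)) xs
SNodeWithQChildren _        = ⊥

{-# OPTIONS --safe #-}
-- In a simple graph no edge occurs twice in the SPQR-tree, so a P-node cannot
-- have two Q-children and the child of the root Q-node cannot itself be a
-- Q-node.  Hence, descending through an R-free tree, either some subtree
-- repeats an edge (impossible) or we reach a non-Q node all of whose children
-- are Q-nodes; it is not a P-node, so it is an S-node.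
module Submission where

open import Defs
open import Data.Nat using (ℕ; _≤_; s≤s; z≤n)
open import Data.Product using (Σ; _×_; _,_; proj₁; proj₂)
open import Data.Sum using (_⊎_; inj₁; inj₂)
open import Data.Unit using (tt)
open import Data.Empty using (⊥-elim)
open import Data.Fin using (Fin)
open import Data.Fin.Properties using (suc-injective)
open import Data.List using (List; []; _∷_; _++_; length)
open import Data.List.Relation.Unary.All as All using (All; []; _∷_)
open import Data.List.Relation.Unary.Any using (Any; here; there; index)
open import Data.List.Relation.Unary.Any.Properties using (++⁺ˡ)
open import Function using (_∘_)
open import Relation.Binary.PropositionalEquality as ≡ using (refl; _≢_)
open import Relation.Nullary using (¬_)

data Twice {A : Set} (P : A → Set) : List A → Set where
  now   : ∀ {x xs} → P x → Any P xs → Twice P (x ∷ xs)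
  later : ∀ {x xs} → Twice P xs → Twice P (x ∷ xs)

module _ {A : Set} {P : A → Set} where

  Twice-++⁺ˡ : ∀ {xs} ys → Twice P xs → Twice P (xs ++ ys)
  Twice-++⁺ˡ ys (now px pxs) = now px (++⁺ˡ pxs)
  Twice-++⁺ˡ ys (later t)    = later (Twice-++⁺ˡ ys t)

  Twice-++⁺ʳ : ∀ xs {ys} → Twice P ys → Twice P (xs ++ ys)
  Twice-++⁺ʳ []       t = t
  Twice-++⁺ʳ (x ∷ xs) t = later (Twice-++⁺ʳ xs t)

  Twice⇒distinct-indices : ∀ {xs} → Twice P xs →
    Σ (Any P xs) λ p → Σ (Any P xs) λ q → index p ≢ index q
  Twice⇒distinct-indices (now px pxs) = here px , there pxs , λ ()
  Twice⇒distinct-indices (later t) with Twice⇒distinct-indices t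
  ... | p , q , p≢q = there p , there q , p≢q ∘ suc-injective

module _ {n : ℕ} where

  SameEdge-refl : {e : Edge n} → SameEdge e e
  SameEdge-refl = inj₁ (refl , refl)

  SameEdge-sym : {e f : Edge n} → SameEdge e f → SameEdge f e
  SameEdge-sym (inj₁ (refl , refl)) = inj₁ (refl , refl)
  SameEdge-sym (inj₂ (refl , refl)) = inj₂ (refl , refl)

  SameEdge-trans : {e f g : Edge n} → SameEdge e f → SameEdge f g → SameEdge e g
  SameEdge-trans (inj₁ (refl , refl)) f~g                  = f~g
  SameEdge-trans (inj₂ (refl , refl)) (inj₁ (refl , refl)) = inj₂ (refl , refl)
  SameEdge-trans (inj₂ (refl , refl)) (inj₂ (refl , refl)) = inj₁ (refl , refl)

  RepeatsEdge : List (Edge n) → Set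
  RepeatsEdge es = Σ (Edge n) λ e → Twice (SameEdge e) es

  Adj-resp-SameEdge : (G : Graph n) {x y : Fin n} {e : Edge n} →
                      SameEdge (x , y) e → Adj G (proj₁ e) (proj₂ e) → Adj G x y
  Adj-resp-SameEdge G (inj₁ (refl , refl)) adj = adj
  Adj-resp-SameEdge G (inj₂ (refl , refl)) adj = Graph.sym G adj

  EdgeSetIs⇒¬RepeatsEdge : (G : Graph n) {es : List (Edge n)} →
                           EdgeSetIs G es → ¬ RepeatsEdge es
  EdgeSetIs⇒¬RepeatsEdge G (adjacent , unique) ((x , y) , twice) =
    let p , q , p≢q      = Twice⇒distinct-indices twice
        adj , xy~e       = All.lookupAny adjacent p
        _ , index-unique = unique x y (Adj-resp-SameEdge G xy~e adj)
    in p≢q (≡.trans (index-unique p) (≡.sym (index-unique q)))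

  RepeatsEdge-realEdgesS : {xs : List (SPQR n × Fin n)} →
    Any (RepeatsEdge ∘ realEdges ∘ proj₁) xs → RepeatsEdge (realEdgesS xs)
  RepeatsEdge-realEdgesS {_ ∷ xs} (here (e , t)) = e , Twice-++⁺ˡ (realEdgesS xs) t
  RepeatsEdge-realEdgesS {(c , _) ∷ _} (there r) with RepeatsEdge-realEdgesS r
  ... | e , t = e , Twice-++⁺ʳ (realEdges c) t

  RepeatsEdge-realEdgesL : {cs : List (SPQR n)} →
    Any (RepeatsEdge ∘ realEdges) cs → RepeatsEdge (realEdgesL cs)
  RepeatsEdge-realEdgesL {_ ∷ cs} (here (e , t)) = e , Twice-++⁺ˡ (realEdgesL cs) t
  RepeatsEdge-realEdgesL {c ∷ _} (there r) with RepeatsEdge-realEdgesL r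
  ... | e , t = e , Twice-++⁺ʳ (realEdges c) t

  parallelQ⇒RepeatsEdge : {s t : Fin n} (cs : List (SPQR n)) → 2 ≤ length cs →
    All (λ c → SameEdge (poles c) (s , t)) cs → All IsQ cs → RepeatsEdge (realEdgesL cs)
  parallelQ⇒RepeatsEdge (Q a b ∷ Q _ _ ∷ _) (s≤s (s≤s z≤n))
                        (ab~st ∷ cd~st ∷ _) (_ ∷ _ ∷ _) =
    (a , b) , now SameEdge-refl (here (SameEdge-trans ab~st (SameEdge-sym cd~st)))

  RFree : SPQR n → Set
  RFree c = ∀ μ → NodeOf μ c → ¬ IsR μ

  ContainsSNodeWithQChildren : SPQR n → Set
  ContainsSNodeWithQChildren c = Σ (SPQR n) λ μ → NodeOf μ c × SNodeWithQChildren μ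

  ContainsSNodeWithQChildren-lift : {A : Set} {f : A → SPQR n} {xs : List A} {c : SPQR n} →
    (∀ {μ} → Any (NodeOf μ ∘ f) xs → NodeOf μ c) →
    Any (ContainsSNodeWithQChildren ∘ f) xs → ContainsSNodeWithQChildren c
  ContainsSNodeWithQChildren-lift into (here (μ , node , sμ)) = μ , into (here node) , sμ
  ContainsSNodeWithQChildren-lift into (there found) =
    ContainsSNodeWithQChildren-lift (into ∘ there) found

  mutual
    Q⊎SNodeWithQChildren⊎RepeatsEdge : (c : SPQR n) → Valid c → RFree c →
      IsQ c ⊎ ContainsSNodeWithQChildren c ⊎ RepeatsEdge (realEdges c)
    Q⊎SNodeWithQChildren⊎RepeatsEdge (Q _ _) _ _ = inj₁ tt
    Q⊎SNodeWithQChildren⊎RepeatsEdge (R _ _ _ _) _ rfree = ⊥-elim (rfree _ here tt)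
    Q⊎SNodeWithQChildren⊎RepeatsEdge (S s xs) (vS _ _ _ _ valid _) rfree
      with childrenQ⊎SNodeWithQChildren⊎RepeatsEdge proj₁ xs valid (λ μ → rfree μ ∘ inS)
    ... | inj₁ allQ           = inj₂ (inj₁ (S s xs , here , allQ))
    ... | inj₂ (inj₁ found)   = inj₂ (inj₁ (ContainsSNodeWithQChildren-lift inS found))
    ... | inj₂ (inj₂ repeats) = inj₂ (inj₂ (RepeatsEdge-realEdgesS repeats))
    Q⊎SNodeWithQChildren⊎RepeatsEdge (P _ _ cs) (vP _ two parallel _ valid _) rfree
      with childrenQ⊎SNodeWithQChildren⊎RepeatsEdge (λ c → c) cs valid (λ μ → rfree μ ∘ inP)
    ... | inj₁ allQ           = inj₂ (inj₂ (parallelQ⇒RepeatsEdge cs two parallel allQ))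
    ... | inj₂ (inj₁ found)   = inj₂ (inj₁ (ContainsSNodeWithQChildren-lift inP found))
    ... | inj₂ (inj₂ repeats) = inj₂ (inj₂ (RepeatsEdge-realEdgesL repeats))

    childrenQ⊎SNodeWithQChildren⊎RepeatsEdge : {A : Set} (f : A → SPQR n) (xs : List A) →
      All (Valid ∘ f) xs → (∀ μ → Any (NodeOf μ ∘ f) xs → ¬ IsR μ) →
      All (IsQ ∘ f) xs ⊎ Any (ContainsSNodeWithQChildren ∘ f) xs ⊎
        Any (RepeatsEdge ∘ realEdges ∘ f) xs
    childrenQ⊎SNodeWithQChildren⊎RepeatsEdge f []       []             _     = inj₁ []
    childrenQ⊎SNodeWithQChildren⊎RepeatsEdge f (x ∷ xs) (valid ∷ valids) rfree
      with Q⊎SNodeWithQChildren⊎RepeatsEdge (f x) valid (λ μ → rfree μ ∘ here)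
    ... | inj₂ (inj₁ found)   = inj₂ (inj₁ (here found))
    ... | inj₂ (inj₂ repeats) = inj₂ (inj₂ (here repeats))
    ... | inj₁ isQ with childrenQ⊎SNodeWithQChildren⊎RepeatsEdge f xs valids (λ μ → rfree μ ∘ there)
    ...   | inj₁ allQ           = inj₁ (isQ ∷ allQ)
    ...   | inj₂ (inj₁ found)   = inj₂ (inj₁ (there found))
    ...   | inj₂ (inj₂ repeats) = inj₂ (inj₂ (there repeats))

lemma1 : (n : ℕ) → 3 ≤ n → (G : Graph n) → SPGraph G →
    (T : RootedSPQR n) → IsSPQRTree G T →
    Σ (SPQR n) (λ μ → NodeOf μ (child T) × SNodeWithQChildren μ)
lemma1 n _ G (_ , noR) T@(root _ _ c) isTree@(_ , valid , _ , edgeSet)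
  with Q⊎SNodeWithQChildren⊎RepeatsEdge c valid (noR T isTree)
... | inj₂ (inj₁ found)       = found
... | inj₂ (inj₂ (e , twice)) = ⊥-elim (EdgeSetIs⇒¬RepeatsEdge G edgeSet (e , later twice))
lemma1 n _ G _ (root u v (Q _ _)) (_ , _ , poles~uv , edgeSet) | inj₁ _ =
  ⊥-elim (EdgeSetIs⇒¬RepeatsEdge G edgeSet
    ((u , v) , now SameEdge-refl (here (SameEdge-sym poles~uv))))
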